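{- Let $n\ge 1$ and $0\le d\le n-1$ be integers. If $\pi$ is chosen uniformly at random from the set of permutations $\pi\in S_n$ with $\mathrm{Des}(\pi)=d$, then the expected value of $\pi(1)$ is $d+1$ and the expected value of $\pi(n)$ is $n-d$.
   Context: $S_n$ is the set of permutations of $\{1,\dots,n\}$. A descent of $\pi\in S_n$ is an index $i$ with $1\le i\le n-1$ and $\pi(i)>\pi(i+1)$; $\mathrm{Des}(\pi)$ is the number of descents of $\pi$. -}

module Defs where

open import Data.Nat using (ℕ; zero; suc; _+_; _*_; _<ᵇ_)
open import Data.Bool using (Bool; true; false; if_then_else_)
open import Data.Fin using (Fin; toℕ)
open import Data.List using (List; []; _∷_; map; concatMap; filter; allFin)
open import Data.List.Relation.Unary.AllPairs using (AllPairs; allPairs?)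
open import Data.Vec using (Vec; []; _∷_; head; last; toList)
open import Relation.Nullary using (¬_; Dec)
open import Relation.Nullary.Decidable using (¬?)
open import Relation.Binary.PropositionalEquality using (_≡_)
open import Data.Fin using (_≟_)

-- A permutation π ∈ S_n is represented by its one-line notation
-- (π(1), …, π(n)) as a vector of length n over Fin n, where the entry
-- k : Fin n stands for the value toℕ k + 1 ∈ {1, …, n}.

words : (n m : ℕ) → List (Vec (Fin n) m)
words n zero = [] ∷ []
words n (suc m) = concatMap (λ x → map (x ∷_) (words n m)) (allFin n)

-- A word is a permutation iff its entries are pairwise distinct
-- (n distinct entries among n values).
IsPerm : {n : ℕ} → Vec (Fin n) n → Set
IsPerm {n} w = AllPairs (λ x y → ¬ (x ≡ y)) (toList w)

isPerm? : {n : ℕ} → (w : Vec (Fin n) n) → Dec (IsPerm w)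
isPerm? w = allPairs? (λ x y → ¬? (x ≟ y)) (toList w)

Sn : (n : ℕ) → List (Vec (Fin n) n)
Sn n = filter isPerm? (words n n)

desList : {n : ℕ} → List (Fin n) → ℕ
desList [] = 0
desList (x ∷ []) = 0
desList (x ∷ y ∷ xs) = (if toℕ y <ᵇ toℕ x then 1 else 0) + desList (y ∷ xs)

Des : {n : ℕ} → Vec (Fin n) n → ℕ
Des π = desList (toList π)

SnDes : (n d : ℕ) → List (Vec (Fin n) n)
SnDes n d = filter (λ π → Data.Nat._≟_ (Des π) d) (Sn n)

val : {n : ℕ} → Fin n → ℕ
val k = suc (toℕ k)

first : {n : ℕ} → Vec (Fin (suc n)) (suc n) → ℕ
first π = val (head π)

lastv : {n : ℕ} → Vec (Fin (suc n)) (suc n) → ℕ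
lastv π = val (last π)

-- Every permutation of {0, …, n} arises exactly once by inserting the maximum n into a permutation
-- τ of {0, …, n-1}. Inserting it in front adds a descent and makes n the first entry; at the end or
-- right after a descent top it adds an ascent; inside an ascent it adds a descent. Hence every sum
-- Σ_π h(des π, asc π, π(1), π(n)) over S_{n+1} is a sum over S_n of an explicit transform of h.
-- With it one shows by induction that Σ c(des, asc)·π(1) = Σ c(des, asc)·(des + 1) for every
-- weight c; taking for c the indicator of des = d gives the mean of π(1). Reversal swaps descents
-- with ascents and π(1) with π(n), and the transform commutes with this swap, so π(n) has mean
-- asc + 1 = n - d.
module Submission where

open import Defs
open import Data.Bool using (Bool; true; false; if_then_else_)
open import Data.Fin using (Fin; toℕ; fromℕ<)
open import Data.Fin.Properties using (toℕ-injective; toℕ<n; toℕ-fromℕ<)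
open import Data.List
  using (List; []; _∷_; [_]; _++_; map; concatMap; length; downFrom; filter)
open import Data.List.Membership.Propositional using (_∈_; _∉_; lose; find)
open import Data.List.Membership.Propositional.Properties
  using (∈-map⁺; ∈-map⁻; ∈-++⁻; ∈-∃++; ∈-concatMap⁺; ∈-concatMap⁻; ∈-downFrom⁺; ∈-downFrom⁻;
         ∈-filter⁺; ∈-filter⁻; ∈-allFin)
open import Data.List.Membership.Propositional.Properties.WithK using (unique∧set⇒bag)
open import Data.List.Properties
  using (map-++; map-∘; map-cong; map-cong-local; map-injective; length-map; length-++;
         length-downFrom; ++-identityʳ; ∷-injectiveˡ; ∷-injectiveʳ; filter-accept; filter-reject;
         filter-all)
open import Data.List.Relation.Binary.BagAndSetEquality using (∼bag⇒↭)
open import Data.List.Relation.Binary.Permutation.Propositional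
  using (_↭_; ↭-refl; ↭-sym; ↭-trans; ↭-prep; ↭⇒↭ₛ)
open import Data.List.Relation.Binary.Permutation.Propositional.Properties
  using (shift; drop-∷; ++⁺ˡ; ↭-length; ∈-resp-↭; All-resp-↭; ↭-empty-inv; map⁺)
open import Data.List.Relation.Binary.Permutation.Setoid.Properties using (Unique-resp-↭)
open import Data.List.Relation.Unary.All as All using (All; []; _∷_)
import Data.List.Relation.Unary.All.Properties as All
open import Data.List.Relation.Unary.Any using (here; there)
open import Data.List.Relation.Unary.Unique.Propositional using (Unique; []; _∷_)
import Data.List.Relation.Unary.Unique.Propositional.Properties as Unique
open import Data.Nat
  using (ℕ; zero; suc; _+_; _*_; _∸_; _≤_; _<_; _<ᵇ_; _≟_; s≤s)
open import Data.Nat.ListAction using (sum)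
open import Data.Nat.ListAction.Properties using (sum-++; sum-↭)
open import Data.Nat.Properties
  using (<-irrefl; <⇒≤; m+1+n≢m; suc-injective; +-suc; +-comm; +-identityʳ; *-identityʳ; *-zeroʳ;
         *-distribˡ-+; m+n∸m≡n; +-∸-assoc; +-commutativeSemigroup)
open import Algebra.Properties.CommutativeSemigroup +-commutativeSemigroup using (interchange)
open import Data.Nat.Tactic.RingSolver using (solve-∀)
open import Data.Product using (∃; _×_; _,_; proj₂)
open import Data.Sum using (inj₁; inj₂)
open import Data.Vec using (Vec; []; _∷_; toList; head; last)
import Data.Vec.Properties as Vec
open import Function using (_∘_; mk⇔)
open import Level using (0ℓ)
open import Relation.Binary.PropositionalEquality
  using (_≡_; refl; sym; trans; cong; cong₂; subst; setoid; module ≡-Reasoning)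
open import Relation.Nullary using (¬_; Dec; does; yes; no; contradiction)
open import Relation.Nullary.Decidable using (¬?)
open import Relation.Unary using (Pred; Decidable)

private
  variable
    A B : Set

sum-map-cong : ∀ {f g : A → ℕ} {xs} → (∀ {x} → x ∈ xs → f x ≡ g x) →
  sum (map f xs) ≡ sum (map g xs)
sum-map-cong f≡g = cong sum (map-cong-local (All.tabulate f≡g))

sum-map-+ : ∀ (f g : A → ℕ) xs → sum (map (λ x → f x + g x) xs) ≡ sum (map f xs) + sum (map g xs)
sum-map-+ f g [] = refl
sum-map-+ f g (x ∷ xs) =
  trans (cong (f x + g x +_) (sum-map-+ f g xs)) (interchange (f x) (g x) _ _)

sum-map-*ˡ : ∀ k (f : A → ℕ) xs → sum (map (λ x → k * f x) xs) ≡ k * sum (map f xs)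
sum-map-*ˡ k f [] = sym (*-zeroʳ k)
sum-map-*ˡ k f (x ∷ xs) =
  trans (cong (k * f x +_) (sum-map-*ˡ k f xs)) (sym (*-distribˡ-+ k (f x) _))

sum-map-concatMap : ∀ (f : B → ℕ) (g : A → List B) xs →
  sum (map f (concatMap g xs)) ≡ sum (map (λ x → sum (map f (g x))) xs)
sum-map-concatMap f g [] = refl
sum-map-concatMap f g (x ∷ xs) = begin
  sum (map f (g x ++ concatMap g xs))
    ≡⟨ cong sum (map-++ f (g x) _) ⟩
  sum (map f (g x) ++ map f (concatMap g xs))
    ≡⟨ sum-++ (map f (g x)) _ ⟩
  sum (map f (g x)) + sum (map f (concatMap g xs))
    ≡⟨ cong (sum (map f (g x)) +_) (sum-map-concatMap f g xs) ⟩
  sum (map f (g x)) + sum (map (λ x → sum (map f (g x))) xs) ∎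
  where open ≡-Reasoning

sum-map-filter : ∀ {P : Pred A 0ℓ} (P? : Decidable P) (f : A → ℕ) xs →
  sum (map f (filter P? xs)) ≡ sum (map (λ x → if does (P? x) then f x else 0) xs)
sum-map-filter P? f [] = refl
sum-map-filter P? f (x ∷ xs) with does (P? x)
... | true = cong (f x +_) (sum-map-filter P? f xs)
... | false = sum-map-filter P? f xs

length≡sum-map-1 : (xs : List A) → length xs ≡ sum (map (λ _ → 1) xs)
length≡sum-map-1 [] = refl
length≡sum-map-1 (x ∷ xs) = cong suc (length≡sum-map-1 xs)

unique-concatMap : (f : A → List B) {xs : List A} → Unique xs →
  (∀ {x} → x ∈ xs → Unique (f x)) →
  (∀ {x y z} → x ∈ xs → y ∈ xs → z ∈ f x → z ∈ f y → x ≡ y) →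
  Unique (concatMap f xs)
unique-concatMap f {[]} [] _ _ = []
unique-concatMap f {x ∷ xs} (x∉xs ∷ xs!) f! disjoint =
  Unique.++⁺ (f! (here refl))
    (unique-concatMap f xs! (f! ∘ there) (λ x∈ y∈ → disjoint (there x∈) (there y∈)))
    λ (z∈fx , z∈rest) → let y , y∈xs , z∈fy = find (∈-concatMap⁻ f {xs = xs} z∈rest) in
      All.lookup x∉xs y∈xs (disjoint (here refl) (there y∈xs) z∈fx z∈fy)

unique-bounded⇒extends-downFrom : ∀ {n} {l : List ℕ} → Unique l → All (_< n) l →
  ∃ λ ys → l ++ ys ↭ downFrom n
unique-bounded⇒extends-downFrom {n} {[]} [] [] = downFrom n , ↭-refl
unique-bounded⇒extends-downFrom {n} {x ∷ l} (x∉l ∷ l!) (x<n ∷ l<n)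
  with ys , l++ys↭ ← unique-bounded⇒extends-downFrom l! l<n
  with ∈-++⁻ l (∈-resp-↭ (↭-sym l++ys↭) (∈-downFrom⁺ x<n))
... | inj₁ x∈l = contradiction refl (All.lookup x∉l x∈l)
... | inj₂ x∈ys with as , bs , refl ← ∈-∃++ x∈ys =
  as ++ bs ,
  ↭-trans (↭-sym (shift x l (as ++ bs))) (↭-trans (++⁺ˡ l (↭-sym (shift x as bs))) l++ys↭)

unique-bounded⇒↭-downFrom : ∀ {n} {l : List ℕ} → Unique l → All (_< n) l → length l ≡ n →
  l ↭ downFrom n
unique-bounded⇒↭-downFrom {l = l} l! l<n refl with unique-bounded⇒extends-downFrom l! l<n
... | [] , l++[]↭ = subst (_↭ downFrom (length l)) (++-identityʳ l) l++[]↭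
... | y ∷ ys , l++ys↭ = contradiction
  (trans (sym (length-++ l)) (trans (↭-length l++ys↭) (length-downFrom (length l))))
  (m+1+n≢m (length l))

↭-downFrom⇒unique : ∀ {n} {l : List ℕ} → l ↭ downFrom n → Unique l
↭-downFrom⇒unique {n} l↭ = Unique-resp-↭ (setoid ℕ) (↭⇒↭ₛ (↭-sym l↭)) (Unique.downFrom⁺ n)

↭-downFrom⇒bounded : ∀ {n} {l : List ℕ} → l ↭ downFrom n → All (_< n) l
↭-downFrom⇒bounded l↭ = All-resp-↭ (↭-sym l↭) (All.tabulate ∈-downFrom⁻)

↭-downFrom⇒length : ∀ {n} {l : List ℕ} → l ↭ downFrom n → length l ≡ n
↭-downFrom⇒length {n} l↭ = trans (↭-length l↭) (length-downFrom n)

insertions : ℕ → List ℕ → List (List ℕ)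
insertions x [] = [ x ∷ [] ]
insertions x (y ∷ ys) = (x ∷ y ∷ ys) ∷ map (y ∷_) (insertions x ys)

permutations : ℕ → List (List ℕ)
permutations zero = [ [] ]
permutations (suc n) = concatMap (insertions n) (permutations n)

∈-insertions⇒↭ : ∀ {x τ σ} → σ ∈ insertions x τ → σ ↭ x ∷ τ
∈-insertions⇒↭ {τ = []} (here refl) = ↭-refl
∈-insertions⇒↭ {τ = y ∷ ys} (here refl) = ↭-refl
∈-insertions⇒↭ {x} {y ∷ ys} (there σ∈) with σ′ , σ′∈ , refl ← ∈-map⁻ (y ∷_) σ∈ =
  ↭-trans (↭-prep y (∈-insertions⇒↭ σ′∈)) (shift x [ y ] ys)

++-∈-insertions : ∀ x (as bs : List ℕ) → as ++ x ∷ bs ∈ insertions x (as ++ bs)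
++-∈-insertions x [] [] = here refl
++-∈-insertions x [] (b ∷ bs) = here refl
++-∈-insertions x (a ∷ as) bs = there (∈-map⁺ (a ∷_) (++-∈-insertions x as bs))

insertions-unique : ∀ {x τ} → x ∉ τ → Unique (insertions x τ)
insertions-unique {τ = []} _ = [] ∷ []
insertions-unique {x} {y ∷ ys} x∉τ =
  All.tabulate x-in-front-only ∷ Unique.map⁺ ∷-injectiveʳ (insertions-unique (x∉τ ∘ there))
  where
  x-in-front-only : ∀ {σ} → σ ∈ map (y ∷_) (insertions x ys) → ¬ (x ∷ y ∷ ys) ≡ σ
  x-in-front-only σ∈ eq with _ , _ , refl ← ∈-map⁻ (y ∷_) σ∈ = x∉τ (here (∷-injectiveˡ eq))

delete-insertions : ∀ {x τ σ} → x ∉ τ → σ ∈ insertions x τ → filter (¬? ∘ (_≟ x)) σ ≡ τ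
delete-insertions {x} {[]} _ (here refl) = filter-reject (¬? ∘ (_≟ x)) (λ x≢x → x≢x refl)
delete-insertions {x} {τ@(_ ∷ _)} x∉τ (here refl) =
  trans (filter-reject (¬? ∘ (_≟ x)) (λ x≢x → x≢x refl))
        (filter-all (¬? ∘ (_≟ x)) (All.tabulate λ y∈τ y≡x → x∉τ (subst (_∈ τ) y≡x y∈τ)))
delete-insertions {x} {y ∷ ys} x∉τ (there σ∈) with σ′ , σ′∈ , refl ← ∈-map⁻ (y ∷_) σ∈ =
  trans (filter-accept (¬? ∘ (_≟ x)) (λ y≡x → x∉τ (here (sym y≡x))))
        (cong (y ∷_) (delete-insertions (x∉τ ∘ there) σ′∈))

∈-permutations⇒↭ : ∀ {n l} → l ∈ permutations n → l ↭ downFrom n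
∈-permutations⇒↭ {zero} (here refl) = ↭-refl
∈-permutations⇒↭ {suc n} l∈
  with τ , τ∈ , l∈τ ← find (∈-concatMap⁻ (insertions n) {xs = permutations n} l∈) =
  ↭-trans (∈-insertions⇒↭ l∈τ) (↭-prep n (∈-permutations⇒↭ τ∈))

↭-downFrom⇒∈-permutations : ∀ {n l} → l ↭ downFrom n → l ∈ permutations n
↭-downFrom⇒∈-permutations {zero} l↭ with refl ← ↭-empty-inv l↭ = here refl
↭-downFrom⇒∈-permutations {suc n} l↭
  with as , bs , refl ← ∈-∃++ (∈-resp-↭ (↭-sym l↭) (here refl)) =
  ∈-concatMap⁺ (insertions n)
    (lose (↭-downFrom⇒∈-permutations (drop-∷ (↭-trans (↭-sym (shift n as bs)) l↭)))
          (++-∈-insertions n as bs))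

max∉permutations : ∀ {n l} → l ∈ permutations n → n ∉ l
max∉permutations l∈ n∈l =
  <-irrefl refl (All.lookup (↭-downFrom⇒bounded (∈-permutations⇒↭ l∈)) n∈l)

permutations-unique : ∀ n → Unique (permutations n)
permutations-unique zero = [] ∷ []
permutations-unique (suc n) =
  unique-concatMap (insertions n) (permutations-unique n) (insertions-unique ∘ max∉permutations)
    λ τ∈ τ′∈ σ∈ σ∈′ → trans (sym (delete-insertions (max∉permutations τ∈) σ∈))
                            (delete-insertions (max∉permutations τ′∈) σ∈′)

toℕs : ∀ {n k} → Vec (Fin n) k → List ℕ
toℕs π = map toℕ (toList π)

toℕs-injective : ∀ {n k} {π π′ : Vec (Fin n) k} → toℕs π ≡ toℕs π′ → π ≡ π′
toℕs-injective {π = π} {π′} eq =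
  trans (sym (Vec.cast-is-id refl π))
        (Vec.toList-injective refl π π′ (map-injective toℕ-injective eq))

words-unique : ∀ n k → Unique (words n k)
words-unique n zero = [] ∷ []
words-unique n (suc k) =
  unique-concatMap _ (Unique.allFin⁺ n) (λ _ → Unique.map⁺ Vec.∷-injectiveʳ (words-unique n k))
    λ _ _ w∈ w∈′ → let _ , _ , w≡ = ∈-map⁻ _ w∈; _ , _ , w≡′ = ∈-map⁻ _ w∈′ in
      Vec.∷-injectiveˡ (trans (sym w≡) w≡′)

∈-words : ∀ {n k} (w : Vec (Fin n) k) → w ∈ words n k
∈-words [] = here refl
∈-words (x ∷ w) = ∈-concatMap⁺ _ (lose (∈-allFin x) (∈-map⁺ (x ∷_) (∈-words w)))

∈-Sn⇒↭ : ∀ {n} {π : Vec (Fin n) n} → π ∈ Sn n → toℕs π ↭ downFrom n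
∈-Sn⇒↭ {n} {π} π∈ = unique-bounded⇒↭-downFrom
  (Unique.map⁺ toℕ-injective (proj₂ (∈-filter⁻ isPerm? {xs = words n n} π∈)))
  (All.map⁺ (All.universal toℕ<n (toList π)))
  (trans (length-map toℕ (toList π)) (Vec.length-toList π))

fromBounded : ∀ {n} (l : List ℕ) → All (_< n) l → Vec (Fin n) (length l)
fromBounded [] [] = []
fromBounded (x ∷ l) (x<n ∷ l<n) = fromℕ< x<n ∷ fromBounded l l<n

toℕs-fromBounded : ∀ {n} (l : List ℕ) (l<n : All (_< n) l) → toℕs (fromBounded l l<n) ≡ l
toℕs-fromBounded [] [] = refl
toℕs-fromBounded (x ∷ l) (x<n ∷ l<n) = cong₂ _∷_ (toℕ-fromℕ< x<n) (toℕs-fromBounded l l<n)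

↭-downFrom⇒∈-Sn : ∀ {n l} → l ↭ downFrom n → l ∈ map toℕs (Sn n)
↭-downFrom⇒∈-Sn {l = l} l↭ with refl ← ↭-downFrom⇒length l↭ =
  subst (_∈ map toℕs (Sn (length l))) π≡l (∈-map⁺ toℕs (∈-filter⁺ isPerm? (∈-words π) π-perm))
  where
  π : Vec (Fin (length l)) (length l)
  π = fromBounded l (↭-downFrom⇒bounded l↭)
  π≡l : toℕs π ≡ l
  π≡l = toℕs-fromBounded l (↭-downFrom⇒bounded l↭)
  π-perm : IsPerm π
  π-perm = Unique.map⁻ (subst Unique (sym π≡l) (↭-downFrom⇒unique l↭))

toℕs-Sn↭permutations : ∀ n → map toℕs (Sn n) ↭ permutations n
toℕs-Sn↭permutations n = ∼bag⇒↭ (unique∧set⇒bag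
  (Unique.map⁺ toℕs-injective (Unique.filter⁺ isPerm? (words-unique n n)))
  (permutations-unique n)
  (mk⇔ (λ l∈ → let π , π∈ , l≡ = ∈-map⁻ toℕs l∈ in
          ↭-downFrom⇒∈-permutations (subst (_↭ downFrom n) (sym l≡) (∈-Sn⇒↭ π∈)))
       (↭-downFrom⇒∈-Sn ∘ ∈-permutations⇒↭)))

descentsFrom ascentsFrom : ℕ → List ℕ → ℕ
descentsFrom x [] = 0
descentsFrom x (y ∷ l) = (if y <ᵇ x then 1 else 0) + descentsFrom y l
ascentsFrom x [] = 0
ascentsFrom x (y ∷ l) = (if y <ᵇ x then 0 else 1) + ascentsFrom y l

lastFrom : ℕ → List ℕ → ℕ
lastFrom x [] = x
lastFrom x (y ∷ l) = lastFrom y l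

descentsFrom+ascentsFrom : ∀ x l → descentsFrom x l + ascentsFrom x l ≡ length l
descentsFrom+ascentsFrom x [] = refl
descentsFrom+ascentsFrom x (y ∷ l) with y <ᵇ x
... | true = cong suc (descentsFrom+ascentsFrom y l)
... | false = trans (+-suc (descentsFrom y l) _) (cong suc (descentsFrom+ascentsFrom y l))

-- h e a x z is the value of a statistic on a nonempty list x ∷ l with e descents, a non-descents
-- (ascents, when entries are distinct) and last entry z.
Statistic : Set
Statistic = ℕ → ℕ → ℕ → ℕ → ℕ

evalFrom : (ℕ → ℕ → ℕ → ℕ) → ℕ → List ℕ → ℕ
evalFrom g x l = g (descentsFrom x l) (ascentsFrom x l) (lastFrom x l)

eval : Statistic → List ℕ → ℕ
eval h [] = 0
eval h (x ∷ l) = evalFrom (λ e a z → h e a x z) x l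

total : Statistic → ℕ → ℕ
total h n = sum (map (eval h) (permutations n))

-- The three terms: N inserted at the end, right after one of the e descent tops, or inside one of
-- the a ascents of x ∷ l.
insertMaxInTail : ℕ → (ℕ → ℕ → ℕ → ℕ) → ℕ → ℕ → ℕ → ℕ
insertMaxInTail N g e a z = g e (suc a) N + e * g e (suc a) z + a * g (suc e) a z

insertMax : ℕ → Statistic → Statistic
insertMax N h e a x z = h (suc e) a N z + insertMaxInTail N (λ e a z → h e a x z) e a z

-- evalFrom g x (y ∷ l) is evalFrom (prepend (y <ᵇ x) g) y l by definition.
prepend : Bool → (ℕ → ℕ → ℕ → ℕ) → ℕ → ℕ → ℕ → ℕ
prepend b g e a z = g ((if b then 1 else 0) + e) ((if b then 0 else 1) + a) z

insertMaxInTail-prepend : ∀ N g b e a z →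
  g (suc e) (suc a) z + insertMaxInTail N (prepend b g) e a z
    ≡ insertMaxInTail N g ((if b then 1 else 0) + e) ((if b then 0 else 1) + a) z
insertMaxInTail-prepend N g true e a z =
  shuffle (g (suc e) (suc a) z) (g (suc e) (suc a) N) (a * g (suc (suc e)) a z) e
  where
  shuffle : ∀ t u v e → t + (u + e * t + v) ≡ u + suc e * t + v
  shuffle = solve-∀
insertMaxInTail-prepend N g false e a z =
  shuffle (g (suc e) (suc a) z) (g e (suc (suc a)) N) (e * g e (suc (suc a)) z) a
  where
  shuffle : ∀ t u v a → t + (u + v + a * t) ≡ u + v + suc a * t
  shuffle = solve-∀

<ᵇ-true : ∀ {m n} → m < n → (m <ᵇ n) ≡ true
<ᵇ-true {zero} {suc n} _ = refl
<ᵇ-true {suc m} {suc n} (s≤s m<n) = <ᵇ-true m<n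

<ᵇ-false : ∀ {m n} → n ≤ m → (m <ᵇ n) ≡ false
<ᵇ-false {m} {zero} _ = refl
<ᵇ-false {suc m} {suc n} (s≤s n≤m) = <ᵇ-false n≤m

sum-insertionsInTail : ∀ {N p} g ys → p < N → All (_< N) ys →
  sum (map (evalFrom g p) (insertions N ys))
    ≡ insertMaxInTail N g (descentsFrom p ys) (ascentsFrom p ys) (lastFrom p ys)
sum-insertionsInTail {N} {p} g [] p<N [] rewrite <ᵇ-false (<⇒≤ p<N) = sym (+-identityʳ _)
sum-insertionsInTail {N} {p} g (y ∷ ys) p<N (y<N ∷ ys<N) = begin
  evalFrom g p (N ∷ y ∷ ys) + sum (map (evalFrom g p) (map (y ∷_) (insertions N ys)))
    ≡⟨ cong₂ _+_ max-second (cong sum (sym (map-∘ (insertions N ys)))) ⟩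
  g (suc e) (suc a) z + sum (map (evalFrom (prepend (y <ᵇ p) g) y) (insertions N ys))
    ≡⟨ cong (g (suc e) (suc a) z +_) (sum-insertionsInTail (prepend (y <ᵇ p) g) ys y<N ys<N) ⟩
  g (suc e) (suc a) z + insertMaxInTail N (prepend (y <ᵇ p) g) e a z
    ≡⟨ insertMaxInTail-prepend N g (y <ᵇ p) e a z ⟩
  insertMaxInTail N g (descentsFrom p (y ∷ ys)) (ascentsFrom p (y ∷ ys)) z ∎
  where
  open ≡-Reasoning
  e a z : ℕ
  e = descentsFrom y ys
  a = ascentsFrom y ys
  z = lastFrom y ys
  max-second : evalFrom g p (N ∷ y ∷ ys) ≡ g (suc e) (suc a) z
  max-second rewrite <ᵇ-false (<⇒≤ p<N) | <ᵇ-true y<N = refl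

sum-insertions : ∀ {N p ys} h → All (_< N) (p ∷ ys) →
  sum (map (eval h) (insertions N (p ∷ ys))) ≡ eval (insertMax N h) (p ∷ ys)
sum-insertions {N} {p} {ys} h (p<N ∷ ys<N) = cong₂ _+_ max-first
  (trans (cong sum (sym (map-∘ (insertions N ys))))
         (sum-insertionsInTail (λ e a z → h e a p z) ys p<N ys<N))
  where
  max-first : eval h (N ∷ p ∷ ys) ≡ h (suc (descentsFrom p ys)) (ascentsFrom p ys) N (lastFrom p ys)
  max-first rewrite <ᵇ-true p<N = refl

sum-permutations-cong : ∀ {m} {f g : List ℕ → ℕ} →
  (∀ {p ys} → length ys ≡ m → All (_< suc m) (p ∷ ys) → f (p ∷ ys) ≡ g (p ∷ ys)) →
  sum (map f (permutations (suc m))) ≡ sum (map g (permutations (suc m)))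
sum-permutations-cong {m} {f} {g} f≡g = sum-map-cong (pointwise ∘ ∈-permutations⇒↭)
  where
  pointwise : ∀ {l} → l ↭ downFrom (suc m) → f l ≡ g l
  pointwise {[]} l↭ with () ← ↭-downFrom⇒length l↭
  pointwise {p ∷ ys} l↭ = f≡g (suc-injective (↭-downFrom⇒length l↭)) (↭-downFrom⇒bounded l↭)

total-suc : ∀ m h → total h (suc (suc m)) ≡ total (insertMax (suc m) h) (suc m)
total-suc m h = trans (sum-map-concatMap (eval h) (insertions (suc m)) (permutations (suc m)))
  (sum-permutations-cong {m} λ _ bounded → sum-insertions h bounded)

total-cong : ∀ {m} {h h′ : Statistic} → (∀ e a x z → e + a ≡ m → h e a x z ≡ h′ e a x z) →
  total h (suc m) ≡ total h′ (suc m)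
total-cong h≡h′ = sum-permutations-cong λ {p} {ys} ∣ys∣≡m _ →
  h≡h′ _ _ p _ (trans (descentsFrom+ascentsFrom p ys) ∣ys∣≡m)

total-+ : ∀ (h h′ : Statistic) n →
  total (λ e a x z → h e a x z + h′ e a x z) n ≡ total h n + total h′ n
total-+ h h′ n =
  trans (cong sum (map-cong eval-+ (permutations n)))
        (sum-map-+ (eval h) (eval h′) (permutations n))
  where
  eval-+ : ∀ l → eval (λ e a x z → h e a x z + h′ e a x z) l ≡ eval h l + eval h′ l
  eval-+ [] = refl
  eval-+ (_ ∷ _) = refl

total-+-congˡ : ∀ (h : Statistic) {h₁ h₂ n} → total h₁ n ≡ total h₂ n →
  total (λ e a x z → h e a x z + h₁ e a x z) n ≡ total (λ e a x z → h e a x z + h₂ e a x z) n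
total-+-congˡ h {h₁} {h₂} {n} eq =
  trans (total-+ h h₁ n) (trans (cong (total h n +_) eq) (sym (total-+ h h₂ n)))

total-*ˡ : ∀ k (h : Statistic) n → total (λ e a x z → k * h e a x z) n ≡ k * total h n
total-*ˡ k h n =
  trans (cong sum (map-cong eval-*ˡ (permutations n)))
        (sum-map-*ˡ k (eval h) (permutations n))
  where
  eval-*ˡ : ∀ l → eval (λ e a x z → k * h e a x z) l ≡ k * eval h l
  eval-*ˡ [] = sym (*-zeroʳ k)
  eval-*ˡ (_ ∷ _) = refl

reverseStatistic : Statistic → Statistic
reverseStatistic h e a x z = h a e z x

insertMax-reverseStatistic : ∀ N h e a x z →
  insertMax N (reverseStatistic h) e a x z ≡ reverseStatistic (insertMax N h) e a x z
insertMax-reverseStatistic N h e a x z =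
  shuffle (h a (suc e) z N) (h (suc a) e N x) (h (suc a) e z x) (h a (suc e) z x) e a
  where
  shuffle : ∀ p q r s e a → p + (q + e * r + a * s) ≡ q + (p + a * s + e * r)
  shuffle = solve-∀

total-reverseStatistic : ∀ m h → total (reverseStatistic h) (suc m) ≡ total h (suc m)
total-reverseStatistic zero h = refl
total-reverseStatistic (suc m) h = begin
  total (reverseStatistic h) (suc (suc m))
    ≡⟨ total-suc m _ ⟩
  total (insertMax (suc m) (reverseStatistic h)) (suc m)
    ≡⟨ total-cong {m} (λ e a x z _ → insertMax-reverseStatistic (suc m) h e a x z) ⟩
  total (reverseStatistic (insertMax (suc m) h)) (suc m)
    ≡⟨ total-reverseStatistic m _ ⟩
  total (insertMax (suc m) h) (suc m)
    ≡⟨ total-suc m h ⟨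
  total h (suc (suc m)) ∎
  where open ≡-Reasoning

-- g e a is the mean of φ over the permutations with e descents and a ascents, φ being applied to
-- the 0-based first and last entries.
ConditionalMean : ℕ → (ℕ → ℕ → ℕ) → (ℕ → ℕ → ℕ) → Set
ConditionalMean n φ g =
  ∀ (c : ℕ → ℕ → ℕ) → total (λ e a x z → c e a * φ x z) n ≡ total (λ e a x z → c e a * g e a) n

first-mean : ∀ m → ConditionalMean (suc m) (λ x _ → suc x) (λ e _ → e + 1)
first-mean zero c = refl
first-mean (suc m) c = begin
  total (λ e a x z → c e a * suc x) (suc (suc m))
    ≡⟨ total-suc m _ ⟩
  total (insertMax (suc m) (λ e a x z → c e a * suc x)) (suc m)
    ≡⟨ total-cong {m} (λ e a x _ _ → expand (c e (suc a)) (c (suc e) a) (suc m) x e a) ⟩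
  total (λ e a x z → c (suc e) a * suc (suc m) + c′ e a * suc x) (suc m)
    ≡⟨ total-+-congˡ (λ e a x z → c (suc e) a * suc (suc m)) {n = suc m} (first-mean m c′) ⟩
  total (λ e a x z → c (suc e) a * suc (suc m) + c′ e a * (e + 1)) (suc m)
    ≡⟨ total-cong {m} (λ e a x _ e+a≡m → collect (c e (suc a)) (c (suc e) a) e a e+a≡m) ⟩
  total (insertMax (suc m) (λ e a x z → c e a * (e + 1))) (suc m)
    ≡⟨ total-suc m _ ⟨
  total (λ e a x z → c e a * (e + 1)) (suc (suc m)) ∎
  where
  open ≡-Reasoning
  c′ : ℕ → ℕ → ℕ
  c′ e a = suc e * c e (suc a) + a * c (suc e) a
  expand : ∀ c₀ c₁ N x e a →
    c₁ * suc N + (c₀ * suc x + e * (c₀ * suc x) + a * (c₁ * suc x))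
      ≡ c₁ * suc N + (suc e * c₀ + a * c₁) * suc x
  expand = solve-∀
  collect : ∀ c₀ c₁ e a → e + a ≡ m →
    c₁ * suc (suc m) + (suc e * c₀ + a * c₁) * (e + 1)
      ≡ c₁ * (suc e + 1) + (c₀ * (e + 1) + e * (c₀ * (e + 1)) + a * (c₁ * (suc e + 1)))
  collect c₀ c₁ e a refl = identity c₀ c₁ e a
    where
    identity : ∀ c₀ c₁ e a →
      c₁ * suc (suc (e + a)) + (suc e * c₀ + a * c₁) * (e + 1)
        ≡ c₁ * (suc e + 1) + (c₀ * (e + 1) + e * (c₀ * (e + 1)) + a * (c₁ * (suc e + 1)))
    identity = solve-∀

last-mean : ∀ m → ConditionalMean (suc m) (λ _ z → suc z) (λ _ a → a + 1)
last-mean m c = begin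
  total (λ e a x z → c e a * suc z) (suc m)
    ≡⟨ total-reverseStatistic m (λ e a x z → c a e * suc x) ⟩
  total (λ e a x z → c a e * suc x) (suc m)
    ≡⟨ first-mean m (λ e a → c a e) ⟩
  total (λ e a x z → c a e * (e + 1)) (suc m)
    ≡⟨ total-reverseStatistic m (λ e a x z → c a e * (e + 1)) ⟨
  total (λ e a x z → c e a * (a + 1)) (suc m) ∎
  where open ≡-Reasoning

δ : ℕ → ℕ → ℕ
δ d e = if does (e ≟ d) then 1 else 0

desList-toℕs : ∀ {n} (x : Fin n) l → desList (x ∷ l) ≡ descentsFrom (toℕ x) (map toℕ l)
desList-toℕs x [] = refl
desList-toℕs x (y ∷ l) = cong (_ +_) (desList-toℕs y l)

last-toℕs : ∀ {n k} (x : Fin n) (xs : Vec (Fin n) k) →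
  toℕ (last (x ∷ xs)) ≡ lastFrom (toℕ x) (toℕs xs)
last-toℕs x [] = refl
last-toℕs x (y ∷ xs) = last-toℕs y xs

if-then-else-0 : ∀ b v → (if b then v else 0) ≡ (if b then 1 else 0) * v
if-then-else-0 true v = sym (+-identityʳ v)
if-then-else-0 false v = refl

sum-SnDes : ∀ m d (φ : ℕ → ℕ → ℕ) →
  sum (map (λ π → φ (toℕ (head π)) (toℕ (last π))) (SnDes (suc m) d))
    ≡ total (λ e a x z → δ d e * φ x z) (suc m)
sum-SnDes m d φ = begin
  sum (map X (SnDes (suc m) d))
    ≡⟨ sum-map-filter (λ π → Des π ≟ d) X (Sn (suc m)) ⟩
  sum (map (λ π → if does (Des π ≟ d) then X π else 0) (Sn (suc m)))
    ≡⟨ cong sum (map-cong pointwise (Sn (suc m))) ⟩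
  sum (map (eval h ∘ toℕs) (Sn (suc m)))
    ≡⟨ cong sum (map-∘ (Sn (suc m))) ⟩
  sum (map (eval h) (map toℕs (Sn (suc m))))
    ≡⟨ sum-↭ (map⁺ (eval h) (toℕs-Sn↭permutations (suc m))) ⟩
  total h (suc m) ∎
  where
  open ≡-Reasoning
  X : Vec (Fin (suc m)) (suc m) → ℕ
  X π = φ (toℕ (head π)) (toℕ (last π))
  h : Statistic
  h e a x z = δ d e * φ x z
  pointwise : ∀ π → (if does (Des π ≟ d) then X π else 0) ≡ eval h (toℕs π)
  pointwise (x ∷ xs) = trans
    (cong₂ (λ e z → if does (e ≟ d) then φ (toℕ x) z else 0)
           (desList-toℕs x (toList xs)) (last-toℕs x xs))
    (if-then-else-0 (does (descentsFrom (toℕ x) (toℕs xs) ≟ d))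
                    (φ (toℕ x) (lastFrom (toℕ x) (toℕs xs))))

mean-SnDes : ∀ m d {φ g} → ConditionalMean (suc m) φ g →
  sum (map (λ π → φ (toℕ (head π)) (toℕ (last π))) (SnDes (suc m) d))
    ≡ g d (m ∸ d) * length (SnDes (suc m) d)
mean-SnDes m d {φ} {g} mean = begin
  sum (map (λ π → φ (toℕ (head π)) (toℕ (last π))) (SnDes (suc m) d))
    ≡⟨ sum-SnDes m d φ ⟩
  total (λ e a x z → δ d e * φ x z) (suc m)
    ≡⟨ mean (λ e _ → δ d e) ⟩
  total (λ e a x z → δ d e * g e a) (suc m)
    ≡⟨ total-cong {m} (λ e a _ _ e+a≡m → concentrate e a e+a≡m (e ≟ d)) ⟩
  total (λ e a x z → k * (δ d e * 1)) (suc m)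
    ≡⟨ total-*ˡ k (λ e a x z → δ d e * 1) (suc m) ⟩
  k * total (λ e a x z → δ d e * 1) (suc m)
    ≡⟨ cong (k *_) (sum-SnDes m d (λ _ _ → 1)) ⟨
  k * sum (map (λ _ → 1) (SnDes (suc m) d))
    ≡⟨ cong (k *_) (length≡sum-map-1 (SnDes (suc m) d)) ⟨
  k * length (SnDes (suc m) d) ∎
  where
  open ≡-Reasoning
  k : ℕ
  k = g d (m ∸ d)
  concentrate : ∀ e a → e + a ≡ m → (e≟d : Dec (e ≡ d)) →
    (if does e≟d then 1 else 0) * g e a ≡ k * ((if does e≟d then 1 else 0) * 1)
  concentrate e a e+a≡m (no _) = sym (*-zeroʳ k)
  concentrate e a e+a≡m (yes refl) =
    trans (+-identityʳ (g e a)) (trans (cong (g e) a≡m∸e) (sym (*-identityʳ k)))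
    where
    a≡m∸e : a ≡ m ∸ e
    a≡m∸e = trans (sym (m+n∸m≡n e a)) (cong (_∸ e) e+a≡m)

theorem3 : (m d : ℕ) → d ≤ m →
    (sum (map first (SnDes (suc m) d)) ≡ (d + 1) * length (SnDes (suc m) d))
    × (sum (map lastv (SnDes (suc m) d)) ≡ (suc m ∸ d) * length (SnDes (suc m) d))
theorem3 m d d≤m =
  mean-SnDes m d (first-mean m) ,
  trans (mean-SnDes m d (last-mean m))
        (cong (_* length (SnDes (suc m) d)) (trans (+-comm (m ∸ d) 1) (sym (+-∸-assoc 1 d≤m))))
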